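{- Let $q\geq 1$ and $t\geq 0$ be integers, let $r=2^{q}(2t+1)$, and let $G$ be an odd-colorable $r$-graph. Then $\chi(G)\leq 2^{q}$.
   Context: An $r$-graph $G=(V(G),E(G))$ is an $r$-uniform hypergraph: a finite vertex set together with a set of edges, each edge being a subset of $V(G)$ of exactly $r$ vertices. Write $[n]=\{1,\dots,n\}$. For even $r\geq 2$, an $r$-graph $G$ with $V(G)=[n]$ is called odd-colorable if there exists a map $\varphi:[n]\to[r]$ such that for every edge $\{j_1,\dots,j_r\}$ of $G$ one has $\varphi(j_1)+\cdots+\varphi(j_r)\equiv r/2 \pmod r$. An $r$-graph is $k$-chromatic if its vertex set can be partitioned into $k$ sets so that every edge intersects at least two of these sets; the chromatic number $\chi(G)$ is the smallest such $k$. -}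

module Defs where

open import Data.Nat using (ℕ; suc; _+_; _*_; _^_; ⌊_/2⌋)
open import Data.Nat.ListAction using (sum)
open import Data.Fin using (Fin; toℕ)
open import Data.List using (List; tabulate)
open import Data.List.Membership.Propositional using (_∈_)
open import Data.Product using (∃; ∃₂; _×_)
open import Function.Definitions using (Injective)
open import Relation.Binary.PropositionalEquality using (_≡_; _≢_)

-- An r-graph on vertex set [n] (represented as Fin n).
-- Each edge is given as an injective map Fin r → Fin n, i.e. an
-- enumeration of its r distinct vertices.
record RGraph (r n : ℕ) : Set where
  field
    edges     : List (Fin r → Fin n)
    edges-inj : ∀ {e} → e ∈ edges → Injective _≡_ _≡_ e
open RGraph public

-- Odd-colorable (r even, r ≥ 2): φ : [n] → [r], where the colour of v is
-- toℕ (φ v) + 1 ∈ {1,…,r}, and for every edge the colour sum is ≡ r/2 mod r.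
-- "x ≡ r/2 (mod r)" is written as ∃ m. x ≡ r/2 + m * r.
OddColorable : (r n : ℕ) → RGraph r n → Set
OddColorable r n G =
  ∃ λ (φ : Fin n → Fin r) → ∀ {e} → e ∈ edges G →
    ∃ λ (m : ℕ) →
      sum (tabulate {n = r} (λ i → suc (toℕ (φ (e i))))) ≡ ⌊ r /2⌋ + m * r

Colorable : (k r n : ℕ) → RGraph r n → Set
Colorable k r n G =
  ∃ λ (c : Fin n → Fin k) → ∀ {e} → e ∈ edges G →
    ∃₂ λ (i j : Fin r) → c (e i) ≢ c (e j)

-- Colour each vertex by its odd-colouring label modulo 2^q. If an edge were
-- monochromatic, its r labels would share one residue mod 2^q, and since 2^q
-- divides r their sum would be divisible by 2^q. But the sum is
-- r/2 + m r = 2^(q-1) (2t+1) (2m+1), an odd multiple of 2^(q-1).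
module Submission where

open import Defs
open import Data.Nat using (ℕ; _*_; _+_; _^_; _≥_; zero; suc; s≤s; z≤n; NonZero; >-nonZero⁻¹; ⌊_/2⌋; _%_; _/_)
open import Data.Nat.Properties using (+-suc; +-comm; *-comm; *-zeroʳ; *-assoc; m^n≢0; m*n≢0; even≢odd)
open import Data.Nat.DivMod using (m≡m%n+[m/n]*n; m%n<n; _mod_)
open import Data.Nat.Divisibility using (_∣_; divides; m∣m*n; ∣m⇒∣m*n; ∣m∣n⇒∣m+n; *-cancelˡ-∣)
open import Data.Nat.ListAction using (sum)
open import Data.Nat.Solver using (module +-*-Solver)
open import Data.Fin using (Fin; toℕ; fromℕ<; _≟_)
open import Data.Fin.Properties using (¬∀⟶∃¬; toℕ-fromℕ<)
open import Data.List using (tabulate)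
open import Data.List.Membership.Propositional using (_∈_)
open import Data.Product using (∃₂; _,_)
open import Function using (_∘_)
open import Relation.Binary.Definitions using (DecidableEquality)
open import Relation.Binary.PropositionalEquality using (_≡_; _≢_; refl; sym; trans; cong; cong₂; subst; module ≡-Reasoning)
open import Relation.Nullary using (¬_)

open +-*-Solver

sum-tabulate-affine : ∀ n (f g : Fin n → ℕ) b M → (∀ i → f i ≡ b + M * g i) →
  sum (tabulate f) ≡ n * b + M * sum (tabulate g)
sum-tabulate-affine zero    f g b M f≡ = sym (*-zeroʳ M)
sum-tabulate-affine (suc n) f g b M f≡ = begin
  f Fin.zero + sum (tabulate (f ∘ Fin.suc))
    ≡⟨ cong₂ _+_ (f≡ Fin.zero) (sum-tabulate-affine n (f ∘ Fin.suc) (g ∘ Fin.suc) b M (f≡ ∘ Fin.suc)) ⟩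
  (b + M * g Fin.zero) + (n * b + M * S)
    ≡⟨ regroup b M (g Fin.zero) n S ⟩
  (b + n * b) + M * (g Fin.zero + S) ∎
  where
  open ≡-Reasoning
  S = sum (tabulate (g ∘ Fin.suc))
  regroup : ∀ b M g₀ n S → (b + M * g₀) + (n * b + M * S) ≡ (b + n * b) + M * (g₀ + S)
  regroup = solve 5 (λ b M g₀ n S → (b :+ M :* g₀) :+ (n :* b :+ M :* S)
                                  := (b :+ n :* b) :+ M :* (g₀ :+ S)) refl

∣-sum-tabulate-of-equal-residues : ∀ {n} M .{{_ : NonZero M}} (f : Fin n → ℕ) a →
  (∀ i → f i % M ≡ a) → M ∣ n → M ∣ sum (tabulate f)
∣-sum-tabulate-of-equal-residues {n} M f a f%M≡a M∣n =
  subst (M ∣_) (sym (sum-tabulate-affine n f (λ i → f i / M) a M f≡a+M*q))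
        (∣m∣n⇒∣m+n (∣m⇒∣m*n a M∣n) (m∣m*n _))
  where
  f≡a+M*q : ∀ i → f i ≡ a + M * (f i / M)
  f≡a+M*q i = trans (m≡m%n+[m/n]*n (f i) M) (cong₂ _+_ (f%M≡a i) (*-comm (f i / M) M))

⌊2*n/2⌋≡n : ∀ n → ⌊ 2 * n /2⌋ ≡ n
⌊2*n/2⌋≡n zero    = refl
⌊2*n/2⌋≡n (suc n) rewrite +-suc n (n + 0) = cong suc (⌊2*n/2⌋≡n n)

⌊r/2⌋+m*r≡odd-multiple : ∀ P t m → let r = 2 * P * (2 * t + 1) in
  ⌊ r /2⌋ + m * r ≡ P * suc (2 * (t + m * (2 * t + 1)))
⌊r/2⌋+m*r≡odd-multiple P t m = begin
  ⌊ 2 * P * (2 * t + 1) /2⌋ + m * (2 * P * (2 * t + 1))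
    ≡⟨ cong (λ h → ⌊ h /2⌋ + m * (2 * P * (2 * t + 1))) (*-assoc 2 P (2 * t + 1)) ⟩
  ⌊ 2 * (P * (2 * t + 1)) /2⌋ + m * (2 * P * (2 * t + 1))
    ≡⟨ cong (_+ m * (2 * P * (2 * t + 1))) (⌊2*n/2⌋≡n (P * (2 * t + 1))) ⟩
  P * (2 * t + 1) + m * (2 * P * (2 * t + 1))
    ≡⟨ factor P t m ⟩
  P * suc (2 * (t + m * (2 * t + 1))) ∎
  where
  open ≡-Reasoning
  factor : ∀ P t m → P * (2 * t + 1) + m * (2 * P * (2 * t + 1)) ≡ P * suc (2 * (t + m * (2 * t + 1)))
  factor = solve 3 (λ P t m → P :* (con 2 :* t :+ con 1) :+ m :* (con 2 :* P :* (con 2 :* t :+ con 1))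
                            := P :* (con 1 :+ con 2 :* (t :+ m :* (con 2 :* t :+ con 1)))) refl

2*P∤P*odd : ∀ P .{{_ : NonZero P}} k → ¬ (2 * P ∣ P * suc (2 * k))
2*P∤P*odd P k 2P∣ with *-cancelˡ-∣ P (subst (_∣ P * suc (2 * k)) (*-comm 2 P) 2P∣)
... | divides q odd≡q*2 = even≢odd q k (sym (trans odd≡q*2 (*-comm q 2)))

non-constant⇒∃-distinct : ∀ {A : Set} → DecidableEquality A → ∀ {r} (z : Fin r) (f : Fin r → A) →
  ¬ (∀ i → f i ≡ f z) → ∃₂ λ i j → f i ≢ f j
non-constant⇒∃-distinct _≟ᴬ_ {r} z f non-constant
  with ¬∀⟶∃¬ r (λ i → f i ≡ f z) (λ i → f i ≟ᴬ f z) non-constant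
... | i , fi≢fz = i , z , fi≢fz

mod≡mod⇒%≡% : ∀ {a b} M .{{_ : NonZero M}} → a mod M ≡ b mod M → a % M ≡ b % M
mod≡mod⇒%≡% {a} {b} M eq =
  trans (sym (toℕ-fromℕ< (m%n<n a M))) (trans (cong toℕ eq) (toℕ-fromℕ< (m%n<n b M)))

mainTheorem1 : (q t n : ℕ) → q ≥ 1 →
    (G : RGraph (2 ^ q * (2 * t + 1)) n) →
    OddColorable (2 ^ q * (2 * t + 1)) n G →
    Colorable (2 ^ q) (2 ^ q * (2 * t + 1)) n G
mainTheorem1 (suc q) t n (s≤s z≤n) G (φ , odd-sum) = colour , bichromatic
  where
  P = 2 ^ q
  M = 2 * P
  r = M * (2 * t + 1)
  instance
    _ : NonZero P
    _ = m^n≢0 2 q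
    _ : NonZero M
    _ = m^n≢0 2 (suc q)
    _ : NonZero (2 * t + 1)
    _ = subst NonZero (+-comm 1 (2 * t)) _
    _ : NonZero r
    _ = m*n≢0 M (2 * t + 1)
  label : Fin n → ℕ
  label v = suc (toℕ (φ v))
  colour : Fin n → Fin M
  colour v = label v mod M
  z : Fin r
  z = fromℕ< (>-nonZero⁻¹ r)
  bichromatic : ∀ {e} → e ∈ edges G → ∃₂ λ i j → colour (e i) ≢ colour (e j)
  bichromatic {e} e∈G = non-constant⇒∃-distinct _≟_ z (colour ∘ e) monochromatic⇒⊥
    where
    monochromatic⇒⊥ : ¬ (∀ i → colour (e i) ≡ colour (e z))
    monochromatic⇒⊥ mono with odd-sum e∈G
    ... | m , sum≡ = 2*P∤P*odd P (t + m * (2 * t + 1))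
      (subst (M ∣_) (trans sum≡ (⌊r/2⌋+m*r≡odd-multiple P t m))
        (∣-sum-tabulate-of-equal-residues M (label ∘ e) (label (e z) % M)
          (λ i → mod≡mod⇒%≡% M (mono i)) (m∣m*n (2 * t + 1))))
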